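{- For any $\vec k=(a,b,\dots,b,b)$ (a first part $a$ followed by any number of parts equal to $b$) with positive integers $a$ and $b$, the polynomial $\widetilde{C}_{\vec{k}}(q,t)=\sum_{\pi\in\mathcal{D}_{\vec k}}q^{\mathrm{area}(\pi)}t^{\mathrm{depth}(\pi)}$ is $q,t$-symmetric. In particular, $\widetilde{C}_{\vec{k}}(q,t)$ is $q,t$-symmetric whenever $\ell(\vec k)=2$.
   Context: For a vector $\vec{k}=(k_1,\dots,k_\ell)$ of positive integers, $\ell(\vec k)=\ell$, $N=|\vec k|+\ell$. A $\vec{k}$-Dyck path is a word $\pi=\pi_1\cdots\pi_N$ consisting of the letters $S^{k_1},\dots,S^{k_\ell}$, each exactly once and in this order from left to right, together with $|\vec k|$ letters $W$, such that the starting ranks $r_1=0$, $r_{i+1}=r_i+k_j$ if $\pi_i=S^{k_j}$, $r_{i+1}=r_i-1$ if $\pi_i=W$, are all nonnegative. $\mathcal{D}_{\vec k}$ is the set of $\vec k$-Dyck paths. The area sequence is $(a_1,\dots,a_\ell)$ with $a_j=r_i$ where $\pi_i=S^{k_j}$; $\mathrm{area}(\pi)=\sum_j a_j$. Filling algorithm $\eta_*$: in a tableau of $\ell$ top-justified columns, column $i$ with $k_i+1$ cells, place $1,\dots,N$ successively: $1$ at the top of column 1; for $i\ge2$, if $\pi_i$ is an $S$-letter put $i$ at the top of the leftmost empty column, and if $\pi_i=W$ put $i$ immediately below the largest active entry (an entry is active if it is currently the bottom-most entry of its column $j$ and that column has fewer than $k_j+1$ entries). Ranking: column 1 gets ranks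 $0,1,\dots,k_1$ top to bottom; for $i\ge2$, if the top entry of column $i$ is $A+1$ and $A$ has rank $\alpha$, column $i$ gets ranks $\alpha,\dots,\alpha+k_i$ top to bottom. $\mathrm{depth}(\pi)$ is the sum of the ranks of the first-row cells of $\eta_*(\pi)$. A polynomial $F(q,t)$ is $q,t$-symmetric if $F(q,t)=F(t,q)$. -}

module Defs where

open import Data.Nat using (ℕ; zero; suc; _+_; _<ᵇ_; _≡ᵇ_; _⊔_)
open import Data.Bool using (Bool; true; false; if_then_else_; _∧_)
open import Data.List using (List; []; _∷_; [_]; _++_; map; filterᵇ; length)
open import Data.Nat.ListAction using (sum)
open import Data.Maybe using (Maybe; just; nothing; maybe; is-just)
open import Data.Product using (_×_; _,_; proj₁; proj₂)
open import Relation.Binary.PropositionalEquality using (_≡_)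

-- A letter of a k⃗-Dyck path.  The S-letters are S^{k_1},…,S^{k_ℓ} in this
-- order, so a word is determined by the positions of its S-letters:
-- the j-th occurrence of S stands for S^{k_j}.
data Letter : Set where
  S W : Letter

words : ℕ → ℕ → List (List Letter)
words zero    zero    = [ [] ]
words zero    (suc w) = map (W ∷_) (words zero w)
words (suc s) zero    = map (S ∷_) (words s zero)
words (suc s) (suc w) = map (S ∷_) (words s (suc w)) ++ map (W ∷_) (words (suc s) w)

-- Returns `nothing` if some rank would become negative (or the letters do
-- not match k⃗), and otherwise the area sequence (a_1,…,a_ℓ), a_j = rank at S^{k_j}.
areaSeq : List ℕ → ℕ → List Letter → Maybe (List ℕ)
areaSeq []       r []      = just []
areaSeq (_ ∷ _)  r []      = nothing
areaSeq []       r (S ∷ π) = nothing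
areaSeq (k ∷ ks) r (S ∷ π) = Data.Maybe.map (r ∷_) (areaSeq ks (r + k) π)
areaSeq ks zero    (W ∷ π) = nothing
areaSeq ks (suc r) (W ∷ π) = areaSeq ks r π

DyckPaths : List ℕ → List (List Letter)
DyckPaths ks = filterᵇ (λ π → is-just (areaSeq ks 0 π)) (words (length ks) (sum ks))

area : List ℕ → List Letter → ℕ
area ks π = maybe sum 0 (areaSeq ks 0 π)

-- The filling algorithm η_* together with the ranking.
-- A column records: its capacity k_j+1, its current number of entries,
-- its current bottom-most entry, and the rank of its top cell.
record Col : Set where
  constructor col
  field
    cap cnt bot top : ℕ

active : Col → Bool
active (col cap cnt _ _) = cnt <ᵇ cap

maxActive : List Col → Maybe ℕ
maxActive [] = nothing
maxActive (c ∷ cs) with maxActive cs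
... | r = if active c then just (maybe (Col.bot c ⊔_) (Col.bot c) r) else r

putBelow : ℕ → ℕ → List Col → List Col × ℕ
putBelow m i [] = [] , 0
putBelow m i (col cap cnt bot top ∷ cs) =
  if active (col cap cnt bot top) ∧ (bot ≡ᵇ m)
  then (col cap (suc cnt) i top ∷ cs , top + cnt)
  else (col cap cnt bot top ∷ proj₁ (putBelow m i cs) , proj₂ (putBelow m i cs))

-- fill ks i ρ cs π : place entries i, i+1, … according to the letters π,
-- where ρ is the rank of entry i-1 (ρ = 0 initially, so column 1 gets
-- ranks 0,…,k_1), cs the columns built so far (left to right), ks the
-- remaining parts of k⃗ for the S-letters still to come.
fill : List ℕ → ℕ → ℕ → List Col → List Letter → List Col
fill ks       i ρ cs []      = cs
fill []       i ρ cs (S ∷ π) = cs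
fill (k ∷ ks) i ρ cs (S ∷ π) = fill ks (suc i) ρ (cs ++ [ col (suc k) 1 i ρ ]) π
fill ks       i ρ cs (W ∷ π) with maxActive cs
... | nothing = cs
... | just m  = fill ks (suc i) (proj₂ (putBelow m i cs)) (proj₁ (putBelow m i cs)) π

depth : List ℕ → List Letter → ℕ
depth ks π = sum (map Col.top (fill ks 1 0 [] π))

-- C̃_k⃗(q,t) = Σ_{π ∈ 𝒟_k⃗} q^area t^depth, given by its coefficients:
-- coeff ks i j = coefficient of q^i t^j.
coeff : List ℕ → ℕ → ℕ → ℕ
coeff ks i j = length (filterᵇ (λ π → (area ks π ≡ᵇ i) ∧ (depth ks π ≡ᵇ j)) (DyckPaths ks))

qtSymmetric : List ℕ → Set
qtSymmetric ks = ∀ i j → coeff ks i j ≡ coeff ks j i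

{-# OPTIONS --safe #-}
-- A k⃗-Dyck path is the preorder encoding of a plane tree whose j-th node has k_j + 1
-- children: the node contributes S^{k_j}, and its children are the stretches of path
-- delimited by its k_j W-letters.  The i-th child of a node with k + 1 children has its S-letter
-- at rank r + k − i, r the rank of the parent's S-letter, whereas the filling algorithm
-- starts the child's column at rank ρ + i, ρ the top rank of the parent's column.  So
-- area reads the children from the right and depth from the left, and reversing the
-- children of every node exchanges the two statistics.  For k⃗ = (a, b, …, b) this
-- reversal keeps the preorder sequence of arities, so it is an involution of 𝒟_k⃗
-- swapping area and depth.
module Submission where

open import Defs
open import Data.Bool using (Bool; true; false; T; T?; _∧_)
open import Data.Bool.Properties using (∧-comm)
open import Data.Empty using (⊥; ⊥-elim)
open import Data.List using (List; []; _∷_; _++_; map; length; reverse; replicate; filterᵇ)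
open import Data.List.Properties
  using ( ++-assoc; ++-identityʳ; ∷-injective; ∷-injectiveʳ; map-++; length-map; length-++
        ; length-++-≤ˡ; length-++-≤ʳ; length-replicate; length-reverse; reverse-map
        ; reverse-involutive; unfold-reverse )
open import Data.List.Membership.Propositional using (_∈_)
open import Data.List.Membership.Propositional.Properties
  using (∈-map⁺; ∈-map⁻; ∈-++⁺ˡ; ∈-++⁺ʳ; ∈-++⁻; ∈-filter⁺; ∈-filter⁻)
open import Data.List.Membership.Propositional.Properties.WithK using (unique∧set⇒bag)
open import Data.List.Relation.Binary.BagAndSetEquality using (∼bag⇒↭)
open import Data.List.Relation.Binary.Permutation.Propositional
  using (_↭_; ↭-refl; ↭-reflexive; ↭-sym; ↭-trans; ↭-prep; module PermutationReasoning)
open import Data.List.Relation.Binary.Permutation.Propositional.Properties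
  using (++⁺; ++-comm; ↭-length; filter-↭; All-resp-↭)
open import Data.List.Relation.Unary.All as All using (All; []; _∷_)
import Data.List.Relation.Unary.All.Properties as Allₚ
import Data.List.Relation.Unary.AllPairs as AllPairs
open import Data.List.Relation.Unary.Any using (here; there)
open import Data.List.Relation.Unary.Unique.Propositional using (Unique)
import Data.List.Relation.Unary.Unique.Propositional.Properties as Uniqueₚ
open import Data.Maybe using (Maybe; just; nothing; maybe; is-just)
import Data.Maybe as Maybe
open import Data.Maybe.Properties using (map-id)
open import Data.Nat using (ℕ; zero; suc; _+_; pred; _≤_; _<_; s≤s; z<s; _<ᵇ_; _≡ᵇ_)
open import Data.Nat.ListAction using (sum)
open import Data.Nat.ListAction.Properties using (sum-++)
open import Data.Nat.Properties
  using ( +-identityʳ; +-suc; +-comm; +-assoc; +-commutativeSemigroup; suc-injective; 0≢1+n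
        ; ≤-refl; ≤-trans; <-≤-trans; <-trans; <⇒≤; m<m+n; n≤1+n; n<1+n; m≤n⇒m⊔n≡n )
open import Algebra.Properties.CommutativeSemigroup +-commutativeSemigroup using (x∙yz≈y∙xz)
open import Data.Product using (Σ; _×_; _,_; proj₁; proj₂; map₁; map₂)
open import Data.Sum using (inj₁; inj₂)
open import Data.Unit using (⊤; tt)
open import Function using (_∘_)
open import Function.Bundles using (mk⇔)
open import Relation.Binary.PropositionalEquality
open import Relation.Nullary using (¬_)

map-++-map : ∀ {A : Set} (xs ys : List A) m →
  Maybe.map (xs ++_) (Maybe.map (ys ++_) m) ≡ Maybe.map ((xs ++ ys) ++_) m
map-++-map xs ys nothing   = refl
map-++-map xs ys (just zs) = cong just (sym (++-assoc xs ys zs))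

all≡⇒replicate : ∀ {A : Set} {x : A} {xs} → All (_≡ x) xs → xs ≡ replicate (length xs) x
all≡⇒replicate []         = refl
all≡⇒replicate (refl ∷ p) = cong (_ ∷_) (all≡⇒replicate p)

↭-replicate : ∀ {A : Set} {x : A} {xs} n → xs ↭ replicate n x → xs ≡ replicate n x
↭-replicate n p = trans (all≡⇒replicate (All-resp-↭ (↭-sym p) (Allₚ.replicate⁺ n refl)))
                        (cong (λ l → replicate l _) (trans (↭-length p) (length-replicate n)))

length-filterᵇ-map : ∀ {A B : Set} (p : B → Bool) (g : A → B) xs →
                     length (filterᵇ p (map g xs)) ≡ length (filterᵇ (p ∘ g) xs)
length-filterᵇ-map p g []       = refl
length-filterᵇ-map p g (x ∷ xs) with p (g x)
... | true  = cong suc (length-filterᵇ-map p g xs)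
... | false = length-filterᵇ-map p g xs

filterᵇ-cong-∈ : ∀ {A : Set} {p q : A → Bool} xs → (∀ {x} → x ∈ xs → p x ≡ q x) →
                 filterᵇ p xs ≡ filterᵇ q xs
filterᵇ-cong-∈ {p = p} {q} []       _   = refl
filterᵇ-cong-∈ {p = p} {q} (x ∷ xs) p≗q with p x | q x | p≗q (here refl)
... | true  | true  | _ = cong (x ∷_) (filterᵇ-cong-∈ xs (p≗q ∘ there))
... | false | false | _ = filterᵇ-cong-∈ xs (p≗q ∘ there)

-- An involution mapping a duplicate-free list into itself permutes it.
count-involution : ∀ {A : Set} (φ : A → A) → (∀ x → φ (φ x) ≡ x) →
                   ∀ {xs} → Unique xs → (∀ {x} → x ∈ xs → φ x ∈ xs) →
                   ∀ p → length (filterᵇ p xs) ≡ length (filterᵇ (p ∘ φ) xs)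
count-involution φ φ-involutive {xs} unique φ∈ p = begin
  length (filterᵇ p xs)          ≡⟨ ↭-length (filter-↭ (T? ∘ p) permutation) ⟨
  length (filterᵇ p (map φ xs))  ≡⟨ length-filterᵇ-map p φ xs ⟩
  length (filterᵇ (p ∘ φ) xs)    ∎
  where
  open ≡-Reasoning
  φ-injective : ∀ {x y} → φ x ≡ φ y → x ≡ y
  φ-injective {x} {y} φx≡φy = trans (sym (φ-involutive x)) (trans (cong φ φx≡φy) (φ-involutive y))
  to : ∀ {y} → y ∈ map φ xs → y ∈ xs
  to y∈ with ∈-map⁻ φ y∈
  ... | _ , x∈ , refl = φ∈ x∈
  from : ∀ {y} → y ∈ xs → y ∈ map φ xs
  from {y} y∈ = subst (_∈ map φ xs) (φ-involutive y) (∈-map⁺ φ (φ∈ y∈))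
  permutation : map φ xs ↭ xs
  permutation = ∼bag⇒↭ (unique∧set⇒bag (Uniqueₚ.map⁺ φ-injective unique) unique (mk⇔ to from))

-- Plane trees

-- A node with children t₀, …, t_k encodes the path S^k t₀ W t₁ W ⋯ W t_k.
data Tree : Set where
  leaf : Tree
  node : List Tree → Tree

mutual
  path : Tree → List Letter
  path leaf      = []
  path (node ts) = S ∷ joinW ts

  joinW : List Tree → List Letter
  joinW []       = []
  joinW (t ∷ ts) = path t ++ prefixW ts

  prefixW : List Tree → List Letter
  prefixW []       = []
  prefixW (t ∷ ts) = W ∷ joinW (t ∷ ts)

-- `node []` is junk: its arity 0 is also that of `node (leaf ∷ [])`, so paths determine
-- trees only when all parts are positive.
mutual
  arities : Tree → List ℕ
  arities leaf      = []
  arities (node ts) = pred (length ts) ∷ aritiesᶠ ts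

  aritiesᶠ : List Tree → List ℕ
  aritiesᶠ []       = []
  aritiesᶠ (t ∷ ts) = arities t ++ aritiesᶠ ts

mutual
  ranks : Tree → ℕ → List ℕ
  ranks leaf      r = []
  ranks (node ts) r = r ∷ ranksᶠ ts r

  ranksᶠ : List Tree → ℕ → List ℕ
  ranksᶠ []       r = []
  ranksᶠ (t ∷ ts) r = ranks t (r + length ts) ++ ranksᶠ ts r

-- The S-letter of the i-th child follows the entry of rank ρ + i in the parent's column
-- (its S-entry for i = 0, its i-th W otherwise), so the child's column starts at rank ρ + i.
mutual
  depthᵗ : Tree → ℕ → ℕ
  depthᵗ leaf      ρ = 0
  depthᵗ (node ts) ρ = ρ + depthᶠ ts ρ

  depthᶠ : List Tree → ℕ → ℕ
  depthᶠ []       ρ = 0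
  depthᶠ (t ∷ ts) ρ = depthᵗ t ρ + depthᶠ ts (suc ρ)

mutual
  mirror : Tree → Tree
  mirror leaf      = leaf
  mirror (node ts) = node (reverse (mirrorᶠ ts))

  mirrorᶠ : List Tree → List Tree
  mirrorᶠ []       = []
  mirrorᶠ (t ∷ ts) = mirror t ∷ mirrorᶠ ts

joinW-split : ∀ {A : Set} (g : List ℕ → List Letter → A) t ts ks π →
  g (aritiesᶠ (t ∷ ts) ++ ks) (joinW (t ∷ ts) ++ π)
    ≡ g (arities t ++ aritiesᶠ ts ++ ks) (path t ++ prefixW ts ++ π)
joinW-split g t ts ks π = cong₂ g (++-assoc (arities t) (aritiesᶠ ts) ks) (++-assoc (path t) (prefixW ts) π)

mirrorᶠ≗map : ∀ ts → mirrorᶠ ts ≡ map mirror ts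
mirrorᶠ≗map []       = refl
mirrorᶠ≗map (t ∷ ts) = cong (mirror t ∷_) (mirrorᶠ≗map ts)

length-mirrorᶠ : ∀ ts → length (mirrorᶠ ts) ≡ length ts
length-mirrorᶠ ts = trans (cong length (mirrorᶠ≗map ts)) (length-map mirror ts)

mirrorᶠ-reverse : ∀ ts → mirrorᶠ (reverse ts) ≡ reverse (mirrorᶠ ts)
mirrorᶠ-reverse ts = begin
  mirrorᶠ (reverse ts)     ≡⟨ mirrorᶠ≗map (reverse ts) ⟩
  map mirror (reverse ts)  ≡⟨ reverse-map mirror ts ⟩
  reverse (map mirror ts)  ≡⟨ cong reverse (mirrorᶠ≗map ts) ⟨
  reverse (mirrorᶠ ts)     ∎
  where open ≡-Reasoning

mutual
  mirror-involutive : ∀ t → mirror (mirror t) ≡ t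
  mirror-involutive leaf      = refl
  mirror-involutive (node ts) = cong node (begin
    reverse (mirrorᶠ (reverse (mirrorᶠ ts)))  ≡⟨ cong reverse (mirrorᶠ-reverse (mirrorᶠ ts)) ⟩
    reverse (reverse (mirrorᶠ (mirrorᶠ ts)))  ≡⟨ reverse-involutive (mirrorᶠ (mirrorᶠ ts)) ⟩
    mirrorᶠ (mirrorᶠ ts)                      ≡⟨ mirrorᶠ-involutive ts ⟩
    ts                                        ∎)
    where open ≡-Reasoning

  mirrorᶠ-involutive : ∀ ts → mirrorᶠ (mirrorᶠ ts) ≡ ts
  mirrorᶠ-involutive []       = refl
  mirrorᶠ-involutive (t ∷ ts) = cong₂ _∷_ (mirror-involutive t) (mirrorᶠ-involutive ts)

ranksᶠ-++ : ∀ ts us r → ranksᶠ (ts ++ us) r ≡ ranksᶠ ts (r + length us) ++ ranksᶠ us r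
ranksᶠ-++ []       us r = refl
ranksᶠ-++ (t ∷ ts) us r = begin
  ranks t (r + length (ts ++ us)) ++ ranksᶠ (ts ++ us) r
    ≡⟨ cong₂ (λ n rs → ranks t n ++ rs) rank-eq (ranksᶠ-++ ts us r) ⟩
  ranks t (r + length us + length ts) ++ ranksᶠ ts (r + length us) ++ ranksᶠ us r
    ≡⟨ ++-assoc (ranks t (r + length us + length ts)) _ _ ⟨
  ranksᶠ (t ∷ ts) (r + length us) ++ ranksᶠ us r ∎
  where
  open ≡-Reasoning
  rank-eq : r + length (ts ++ us) ≡ r + length us + length ts
  rank-eq = trans (cong (r +_) (trans (length-++ ts) (+-comm (length ts) (length us))))
                  (sym (+-assoc r (length us) (length ts)))

mutual
  sum-ranks-mirror : ∀ t r → sum (ranks (mirror t) r) ≡ depthᵗ t r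
  sum-ranks-mirror leaf      r = refl
  sum-ranks-mirror (node ts) r = cong (r +_) (sum-ranksᶠ-mirror ts r)

  sum-ranksᶠ-mirror : ∀ ts r → sum (ranksᶠ (reverse (mirrorᶠ ts)) r) ≡ depthᶠ ts r
  sum-ranksᶠ-mirror []       r = refl
  sum-ranksᶠ-mirror (t ∷ ts) r = begin
    sum (ranksᶠ (reverse (mirrorᶠ (t ∷ ts))) r)
      ≡⟨ cong (λ us → sum (ranksᶠ us r)) (unfold-reverse (mirror t) (mirrorᶠ ts)) ⟩
    sum (ranksᶠ (reverse (mirrorᶠ ts) ++ mirror t ∷ []) r)
      ≡⟨ cong sum (ranksᶠ-++ (reverse (mirrorᶠ ts)) (mirror t ∷ []) r) ⟩
    sum (ranksᶠ (reverse (mirrorᶠ ts)) (r + 1) ++ ranks (mirror t) (r + 0) ++ [])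
      ≡⟨ cong₂ (λ n rs → sum (ranksᶠ (reverse (mirrorᶠ ts)) n ++ rs))
               (+-comm r 1) (trans (++-identityʳ _) (cong (ranks (mirror t)) (+-identityʳ r))) ⟩
    sum (ranksᶠ (reverse (mirrorᶠ ts)) (suc r) ++ ranks (mirror t) r)
      ≡⟨ sum-++ (ranksᶠ (reverse (mirrorᶠ ts)) (suc r)) (ranks (mirror t) r) ⟩
    sum (ranksᶠ (reverse (mirrorᶠ ts)) (suc r)) + sum (ranks (mirror t) r)
      ≡⟨ cong₂ _+_ (sum-ranksᶠ-mirror ts (suc r)) (sum-ranks-mirror t r) ⟩
    depthᶠ ts (suc r) + depthᵗ t r
      ≡⟨ +-comm (depthᶠ ts (suc r)) (depthᵗ t r) ⟩
    depthᶠ (t ∷ ts) r ∎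
    where open ≡-Reasoning

depth-mirror : ∀ t r → depthᵗ (mirror t) r ≡ sum (ranks t r)
depth-mirror t r = begin
  depthᵗ (mirror t) r                 ≡⟨ sum-ranks-mirror (mirror t) r ⟨
  sum (ranks (mirror (mirror t)) r)   ≡⟨ cong (λ u → sum (ranks u r)) (mirror-involutive t) ⟩
  sum (ranks t r)                     ∎
  where open ≡-Reasoning

aritiesᶠ-++ : ∀ ts us → aritiesᶠ (ts ++ us) ≡ aritiesᶠ ts ++ aritiesᶠ us
aritiesᶠ-++ []       us = refl
aritiesᶠ-++ (t ∷ ts) us =
  trans (cong (arities t ++_) (aritiesᶠ-++ ts us)) (sym (++-assoc (arities t) (aritiesᶠ ts) (aritiesᶠ us)))

aritiesᶠ-reverse : ∀ ts → aritiesᶠ (reverse ts) ↭ aritiesᶠ ts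
aritiesᶠ-reverse []       = ↭-refl
aritiesᶠ-reverse (t ∷ ts) = begin
  aritiesᶠ (reverse (t ∷ ts))            ≡⟨ cong aritiesᶠ (unfold-reverse t ts) ⟩
  aritiesᶠ (reverse ts ++ t ∷ [])        ≡⟨ aritiesᶠ-++ (reverse ts) (t ∷ []) ⟩
  aritiesᶠ (reverse ts) ++ arities t ++ []
    ↭⟨ ++⁺ (aritiesᶠ-reverse ts) (↭-reflexive (++-identityʳ (arities t))) ⟩
  aritiesᶠ ts ++ arities t               ↭⟨ ++-comm (aritiesᶠ ts) (arities t) ⟩
  aritiesᶠ (t ∷ ts)                      ∎
  where open PermutationReasoning

mutual
  aritiesᶠ-mirror : ∀ ts → aritiesᶠ (reverse (mirrorᶠ ts)) ↭ aritiesᶠ ts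
  aritiesᶠ-mirror ts = ↭-trans (aritiesᶠ-reverse (mirrorᶠ ts)) (aritiesᶠ-mirrorᶠ ts)

  aritiesᶠ-mirrorᶠ : ∀ ts → aritiesᶠ (mirrorᶠ ts) ↭ aritiesᶠ ts
  aritiesᶠ-mirrorᶠ []       = ↭-refl
  aritiesᶠ-mirrorᶠ (t ∷ ts) = ++⁺ (arities-mirror t) (aritiesᶠ-mirrorᶠ ts)

  arities-mirror : ∀ t → arities (mirror t) ↭ arities t
  arities-mirror leaf      = ↭-refl
  arities-mirror (node ts) rewrite length-reverse (mirrorᶠ ts) | length-mirrorᶠ ts =
    ↭-prep (pred (length ts)) (aritiesᶠ-mirror ts)

-- Area

areaSeq-W : ∀ ks r π → areaSeq ks (suc r) (W ∷ π) ≡ areaSeq ks r π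
areaSeq-W []       r π = refl
areaSeq-W (k ∷ ks) r π = refl

mutual
  areaSeq-path : ∀ t ks r π →
    areaSeq (arities t ++ ks) r (path t ++ π) ≡ Maybe.map (ranks t r ++_) (areaSeq ks r π)
  areaSeq-path leaf ks r π = sym (map-id (areaSeq ks r π))
  areaSeq-path (node []) ks r π rewrite +-identityʳ r = refl
  areaSeq-path (node (t ∷ ts)) ks r π =
    trans (cong (Maybe.map (r ∷_)) (areaSeq-joinW t ts ks r π))
          (map-++-map (r ∷ []) (ranksᶠ (t ∷ ts) r) (areaSeq ks r π))

  areaSeq-joinW : ∀ t ts ks r π →
    areaSeq (aritiesᶠ (t ∷ ts) ++ ks) (r + length ts) (joinW (t ∷ ts) ++ π)
      ≡ Maybe.map (ranksᶠ (t ∷ ts) r ++_) (areaSeq ks r π)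
  areaSeq-joinW t ts ks r π = begin
    areaSeq (aritiesᶠ (t ∷ ts) ++ ks) (r + length ts) (joinW (t ∷ ts) ++ π)
      ≡⟨ joinW-split (λ ks′ π′ → areaSeq ks′ (r + length ts) π′) t ts ks π ⟩
    areaSeq (arities t ++ aritiesᶠ ts ++ ks) (r + length ts) (path t ++ prefixW ts ++ π)
      ≡⟨ areaSeq-path t (aritiesᶠ ts ++ ks) (r + length ts) (prefixW ts ++ π) ⟩
    Maybe.map (ranks t (r + length ts) ++_) (areaSeq (aritiesᶠ ts ++ ks) (r + length ts) (prefixW ts ++ π))
      ≡⟨ cong (Maybe.map (ranks t (r + length ts) ++_)) (areaSeq-prefixW ts ks r π) ⟩
    Maybe.map (ranks t (r + length ts) ++_) (Maybe.map (ranksᶠ ts r ++_) (areaSeq ks r π))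
      ≡⟨ map-++-map (ranks t (r + length ts)) (ranksᶠ ts r) (areaSeq ks r π) ⟩
    Maybe.map (ranksᶠ (t ∷ ts) r ++_) (areaSeq ks r π) ∎
    where open ≡-Reasoning

  areaSeq-prefixW : ∀ ts ks r π →
    areaSeq (aritiesᶠ ts ++ ks) (r + length ts) (prefixW ts ++ π)
      ≡ Maybe.map (ranksᶠ ts r ++_) (areaSeq ks r π)
  areaSeq-prefixW [] ks r π rewrite +-identityʳ r = sym (map-id (areaSeq ks r π))
  areaSeq-prefixW (t ∷ ts) ks r π rewrite +-suc r (length ts) =
    trans (areaSeq-W (aritiesᶠ (t ∷ ts) ++ ks) (r + length ts) (joinW (t ∷ ts) ++ π))
          (areaSeq-joinW t ts ks r π)

areaSeq-path-[] : ∀ t r → areaSeq (arities t) r (path t) ≡ just (ranks t r)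
areaSeq-path-[] t r = begin
  areaSeq (arities t) r (path t)
    ≡⟨ cong₂ (λ ks π → areaSeq ks r π) (++-identityʳ (arities t)) (++-identityʳ (path t)) ⟨
  areaSeq (arities t ++ []) r (path t ++ [])
    ≡⟨ areaSeq-path t [] r [] ⟩
  just (ranks t r ++ [])
    ≡⟨ cong just (++-identityʳ (ranks t r)) ⟩
  just (ranks t r) ∎
  where open ≡-Reasoning

area-path : ∀ t → area (arities t) (path t) ≡ sum (ranks t 0)
area-path t = cong (maybe sum 0) (areaSeq-path-[] t 0)

-- Depth

open Col

<ᵇ-irrefl : ∀ n → (n <ᵇ n) ≡ false
<ᵇ-irrefl zero    = refl
<ᵇ-irrefl (suc n) = <ᵇ-irrefl n

<⇒<ᵇ≡true : ∀ {m n} → m < n → (m <ᵇ n) ≡ true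
<⇒<ᵇ≡true {zero}  {suc n} _         = refl
<⇒<ᵇ≡true {suc m} {suc n} (s≤s m<n) = <⇒<ᵇ≡true m<n

<⇒≡ᵇ≡false : ∀ {m n} → m < n → (m ≡ᵇ n) ≡ false
<⇒≡ᵇ≡false {zero}  {suc n} _         = refl
<⇒≡ᵇ≡false {suc m} {suc n} (s≤s m<n) = <⇒≡ᵇ≡false m<n

≡ᵇ-refl : ∀ n → (n ≡ᵇ n) ≡ true
≡ᵇ-refl zero    = refl
≡ᵇ-refl (suc n) = ≡ᵇ-refl n

Full : Col → Set
Full c = cnt c ≡ cap c

-- The bottom entry of a column is its largest one, so all entries of a closed
-- column are smaller than i.
Closed : ℕ → Col → Set
Closed i c = Full c × bot c < i

Below : ℕ → Col → Set
Below b c = bot c < b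

closed-mono : ∀ {i j} → i ≤ j → ∀ {cs} → All (Closed i) cs → All (Closed j) cs
closed-mono i≤j = All.map (map₂ (λ b<i → <-≤-trans b<i i≤j))

maxActive-full : ∀ {cs} → All Full cs → maxActive cs ≡ nothing
maxActive-full {[]}                     []          = refl
maxActive-full {col cap _ _ _ ∷ cs} (refl ∷ fs) rewrite maxActive-full fs | <ᵇ-irrefl cap = refl

maxActive-focus : ∀ cs {cp n b τ ds} → All (Below b) cs → n < cp → All Full ds →
                  maxActive (cs ++ col cp n b τ ∷ ds) ≡ just b
maxActive-focus [] [] n<cp fs rewrite maxActive-full fs | <⇒<ᵇ≡true n<cp = refl
maxActive-focus (c ∷ cs) {τ = τ} (c<b ∷ cs<b) n<cp fs
  rewrite maxActive-focus cs {τ = τ} cs<b n<cp fs with active c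
... | true  = cong just (m≤n⇒m⊔n≡n (<⇒≤ c<b))
... | false = refl

putBelow-focus : ∀ cs {cp n b τ ds} i → All (Below b) cs → n < cp →
                 putBelow b i (cs ++ col cp n b τ ∷ ds) ≡ (cs ++ col cp (suc n) i τ ∷ ds , τ + n)
putBelow-focus [] {b = b} i [] n<cp rewrite <⇒<ᵇ≡true n<cp | ≡ᵇ-refl b = refl
putBelow-focus (col cap cnt _ _ ∷ cs) {τ = τ} {ds} i (c<b ∷ cs<b) n<cp
  rewrite <⇒≡ᵇ≡false c<b | putBelow-focus cs {τ = τ} {ds = ds} i cs<b n<cp with cnt <ᵇ cap
... | true  = refl
... | false = refl

fill-W : ∀ ks i ρ cs π {m} → maxActive cs ≡ just m →
  fill ks i ρ cs (W ∷ π) ≡ fill ks (suc i) (proj₂ (putBelow m i cs)) (proj₁ (putBelow m i cs)) π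
fill-W []      i ρ cs π eq rewrite eq = refl
fill-W (_ ∷ _) i ρ cs π eq rewrite eq = refl

fill-W-focus : ∀ ks i ρ cs {cp n b τ ds} π → All (Below b) cs → n < cp → All Full ds →
  fill ks i ρ (cs ++ col cp n b τ ∷ ds) (W ∷ π)
    ≡ fill ks (suc i) (τ + n) (cs ++ col cp (suc n) i τ ∷ ds) π
fill-W-focus ks i ρ cs {τ = τ} {ds} π cs<b n<cp fs =
  trans (fill-W ks i ρ (cs ++ _ ∷ ds) π (maxActive-focus cs {τ = τ} cs<b n<cp fs))
        (cong (λ (cs′ , ρ′) → fill ks (suc i) ρ′ cs′ π) (putBelow-focus cs {τ = τ} {ds = ds} i cs<b n<cp))

-- `Reaches run ks π i cs d`: the run of the filling algorithm passes through a state
-- with parts ks and letters π still to be processed and next entry at least i, in which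
-- closed columns whose tops sum to d have been appended to cs.
record Reaches (run : List Col) (ks : List ℕ) (π : List Letter) (i : ℕ) (cs : List Col) (d : ℕ) : Set where
  field
    next rank : ℕ
    new       : List Col
    i≤next    : i ≤ next
    closed    : All (Closed next) new
    tops      : sum (map top new) ≡ d
    reaches   : run ≡ fill ks next rank (cs ++ new) π

reaches-cast : ∀ {run run′ ks π i i′ cs d d′} → run ≡ run′ → i ≤ i′ → d′ ≡ d →
               Reaches run′ ks π i′ cs d′ → Reaches run ks π i cs d
reaches-cast run≡ i≤i′ d≡ R = record
  { next = next ; rank = rank ; new = new ; i≤next = ≤-trans i≤i′ i≤next ; closed = closed
  ; tops = trans tops d≡ ; reaches = trans run≡ reaches }
  where open Reaches R

sum-tops-++ : ∀ cs ds → sum (map top (cs ++ ds)) ≡ sum (map top cs) + sum (map top ds)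
sum-tops-++ cs ds = trans (cong sum (map-++ top cs ds)) (sum-++ (map top cs) (map top ds))

below-focus : ∀ cs {b i cp m τ ds} → All (Below b) cs → b < i → All (Closed i) ds →
              All (Below i) (cs ++ col cp m b τ ∷ ds)
below-focus cs cs<b b<i ds-closed =
  Allₚ.++⁺ (All.map (λ c<b → <-trans c<b b<i) cs<b) (b<i ∷ All.map proj₂ ds-closed)

mutual
  fill-path : ∀ t ks π {i ρ cs} → All (Below i) cs →
    Reaches (fill (arities t ++ ks) i ρ cs (path t ++ π)) ks π i cs (depthᵗ t ρ)
  fill-path leaf ks π {i} {ρ} {cs} _ = record
    { new = [] ; i≤next = ≤-refl ; closed = [] ; tops = refl
    ; reaches = cong (λ cs′ → fill ks i ρ cs′ π) (sym (++-identityʳ cs)) }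
  fill-path (node []) ks π {i} {ρ} _ = record
    { new = col 1 1 i ρ ∷ [] ; i≤next = n≤1+n i ; closed = (refl , n<1+n i) ∷ []
    ; tops = refl ; reaches = refl }
  fill-path (node (t ∷ ts)) ks π {i} cs<i =
    reaches-cast refl (n≤1+n i) refl
      (fill-joinW t ts ks π {n = 0} {ds = []} cs<i (n<1+n i) [] (sym (+-identityʳ _)) refl)

  fill-joinW : ∀ t ts ks π {i ρ cs cp n b τ ds} → All (Below b) cs → b < i → All (Closed i) ds →
    ρ ≡ τ + n → suc n + length ts ≡ cp →
    Reaches (fill (aritiesᶠ (t ∷ ts) ++ ks) i ρ (cs ++ col cp (suc n) b τ ∷ ds) (joinW (t ∷ ts) ++ π))
            ks π i cs (τ + (sum (map top ds) + depthᶠ (t ∷ ts) ρ))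
  fill-joinW t [] ks π {i} {ρ} {cs} {cp} {n} {b} {τ} {ds} cs<b b<i ds-closed ρ≡ h = record
    { next = next ; rank = rank ; new = col cp (suc n) b τ ∷ ds ++ new ; i≤next = i≤next
    ; closed = (trans (sym (+-identityʳ (suc n))) h , <-≤-trans b<i i≤next)
               ∷ Allₚ.++⁺ (closed-mono i≤next ds-closed) closed
    ; tops = cong (τ +_) (trans (sum-tops-++ ds new)
                                (cong (sum (map top ds) +_) (trans tops (sym (+-identityʳ _)))))
    ; reaches = trans (joinW-split (λ ks′ π′ → fill ks′ i ρ (cs ++ col cp (suc n) b τ ∷ ds) π′)
                                   t [] ks π)
                      (trans reaches (cong (λ cs′ → fill ks next rank cs′ π)
                                           (++-assoc cs (col cp (suc n) b τ ∷ ds) new)))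
    }
    where open Reaches (fill-path t ks π {i} {ρ} (below-focus cs cs<b b<i ds-closed))
  fill-joinW t (u ∷ us) ks π {i} {ρ} {cs} {cp} {n} {b} {τ} {ds} cs<b b<i ds-closed ρ≡ h =
    reaches-cast (trans split (trans R₁.reaches step)) (≤-trans R₁.i≤next (n≤1+n R₁.next)) tops-eq
      (fill-joinW u us ks π cs<next (n<1+n R₁.next) old-closed refl
                  (trans (sym (+-suc (suc n) (length us))) h))
    where
    module R₁ = Reaches (fill-path t (aritiesᶠ (u ∷ us) ++ ks) (prefixW (u ∷ us) ++ π) {i} {ρ}
                                   (below-focus cs cs<b b<i ds-closed))
    ks′ = aritiesᶠ (u ∷ us) ++ ks
    π′  = joinW (u ∷ us) ++ π
    split = joinW-split (λ ks′ π′ → fill ks′ i ρ (cs ++ col cp (suc n) b τ ∷ ds) π′)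
                        t (u ∷ us) ks π
    old-closed : All (Closed (suc R₁.next)) (ds ++ R₁.new)
    old-closed = closed-mono (n≤1+n R₁.next) (Allₚ.++⁺ (closed-mono R₁.i≤next ds-closed) R₁.closed)
    cs<next : All (Below R₁.next) cs
    cs<next = All.map (λ c<b → <-≤-trans (<-trans c<b b<i) R₁.i≤next) cs<b
    step : fill ks′ R₁.next R₁.rank ((cs ++ col cp (suc n) b τ ∷ ds) ++ R₁.new) (W ∷ π′)
         ≡ fill ks′ (suc R₁.next) (τ + suc n) (cs ++ col cp (suc (suc n)) R₁.next τ ∷ ds ++ R₁.new) π′
    step = trans (cong (λ cs′ → fill ks′ R₁.next R₁.rank cs′ (W ∷ π′))
                       (++-assoc cs (col cp (suc n) b τ ∷ ds) R₁.new))
                 (fill-W-focus ks′ R₁.next R₁.rank cs {τ = τ} π′ cs<b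
                               (subst (suc n <_) h (m<m+n (suc n) z<s)) (All.map proj₁ old-closed))
    tops-eq : τ + (sum (map top (ds ++ R₁.new)) + depthᶠ (u ∷ us) (τ + suc n))
            ≡ τ + (sum (map top ds) + depthᶠ (t ∷ u ∷ us) ρ)
    tops-eq = cong (τ +_) (begin
      sum (map top (ds ++ R₁.new)) + depthᶠ (u ∷ us) (τ + suc n)
        ≡⟨ cong₂ _+_ (sum-tops-++ ds R₁.new)
                     (cong (depthᶠ (u ∷ us)) (trans (+-suc τ n) (cong suc (sym ρ≡)))) ⟩
      sum (map top ds) + sum (map top R₁.new) + depthᶠ (u ∷ us) (suc ρ)
        ≡⟨ cong (λ d → sum (map top ds) + d + depthᶠ (u ∷ us) (suc ρ)) R₁.tops ⟩
      sum (map top ds) + depthᵗ t ρ + depthᶠ (u ∷ us) (suc ρ)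
        ≡⟨ +-assoc (sum (map top ds)) (depthᵗ t ρ) (depthᶠ (u ∷ us) (suc ρ)) ⟩
      sum (map top ds) + depthᶠ (t ∷ u ∷ us) ρ ∎)
      where open ≡-Reasoning

depth-path : ∀ t → depth (arities t) (path t) ≡ depthᵗ t 0
depth-path t = begin
  sum (map top (fill (arities t) 1 0 [] (path t)))
    ≡⟨ cong₂ (λ ks π → sum (map top (fill ks 1 0 [] π))) (++-identityʳ (arities t)) (++-identityʳ (path t)) ⟨
  sum (map top (fill (arities t ++ []) 1 0 [] (path t ++ [])))
    ≡⟨ cong (λ cs → sum (map top cs)) reaches ⟩
  sum (map top new)
    ≡⟨ tops ⟩
  depthᵗ t 0 ∎
  where
  open ≡-Reasoning
  open Reaches (fill-path t [] [] {1} {0} {[]} [])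

countS : List Letter → ℕ
countS []      = 0
countS (S ∷ π) = suc (countS π)
countS (W ∷ π) = countS π

countW : List Letter → ℕ
countW []      = 0
countW (S ∷ π) = countW π
countW (W ∷ π) = suc (countW π)

countS-++ : ∀ π π′ → countS (π ++ π′) ≡ countS π + countS π′
countS-++ []      π′ = refl
countS-++ (S ∷ π) π′ = cong suc (countS-++ π π′)
countS-++ (W ∷ π) π′ = countS-++ π π′

countW-++ : ∀ π π′ → countW (π ++ π′) ≡ countW π + countW π′
countW-++ []      π′ = refl
countW-++ (S ∷ π) π′ = countW-++ π π′
countW-++ (W ∷ π) π′ = cong suc (countW-++ π π′)

mutual
  countS-path : ∀ t → countS (path t) ≡ length (arities t)
  countS-path leaf      = refl
  countS-path (node ts) = cong suc (countS-joinW ts)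

  countS-joinW : ∀ ts → countS (joinW ts) ≡ length (aritiesᶠ ts)
  countS-joinW []       = refl
  countS-joinW (t ∷ ts) = begin
    countS (path t ++ prefixW ts)              ≡⟨ countS-++ (path t) (prefixW ts) ⟩
    countS (path t) + countS (prefixW ts)      ≡⟨ cong₂ _+_ (countS-path t) (countS-prefixW ts) ⟩
    length (arities t) + length (aritiesᶠ ts)  ≡⟨ length-++ (arities t) ⟨
    length (aritiesᶠ (t ∷ ts))                 ∎
    where open ≡-Reasoning

  countS-prefixW : ∀ ts → countS (prefixW ts) ≡ length (aritiesᶠ ts)
  countS-prefixW []       = refl
  countS-prefixW (t ∷ ts) = countS-joinW (t ∷ ts)

mutual
  countW-path : ∀ t → countW (path t) ≡ sum (arities t)
  countW-path leaf      = refl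
  countW-path (node ts) = countW-joinW ts

  countW-joinW : ∀ ts → countW (joinW ts) ≡ pred (length ts) + sum (aritiesᶠ ts)
  countW-joinW []       = refl
  countW-joinW (t ∷ ts) = begin
    countW (path t ++ prefixW ts)                    ≡⟨ countW-++ (path t) (prefixW ts) ⟩
    countW (path t) + countW (prefixW ts)            ≡⟨ cong₂ _+_ (countW-path t) (countW-prefixW ts) ⟩
    sum (arities t) + (length ts + sum (aritiesᶠ ts)) ≡⟨ x∙yz≈y∙xz (sum (arities t)) (length ts) _ ⟩
    length ts + (sum (arities t) + sum (aritiesᶠ ts)) ≡⟨ cong (length ts +_) (sum-++ (arities t) (aritiesᶠ ts)) ⟨
    length ts + sum (aritiesᶠ (t ∷ ts))              ∎
    where open ≡-Reasoning

  countW-prefixW : ∀ ts → countW (prefixW ts) ≡ length ts + sum (aritiesᶠ ts)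
  countW-prefixW []       = refl
  countW-prefixW (t ∷ ts) = cong suc (countW-joinW (t ∷ ts))

∈-words⁻ : ∀ s w {π} → π ∈ words s w → countS π ≡ s × countW π ≡ w
∈-words⁻ zero    zero    (here refl) = refl , refl
∈-words⁻ zero    (suc w) π∈ with ∈-map⁻ (W ∷_) π∈
... | _ , π′∈ , refl = map₂ (cong suc) (∈-words⁻ zero w π′∈)
∈-words⁻ (suc s) zero    π∈ with ∈-map⁻ (S ∷_) π∈
... | _ , π′∈ , refl = map₁ (cong suc) (∈-words⁻ s zero π′∈)
∈-words⁻ (suc s) (suc w) π∈ with ∈-++⁻ (map (S ∷_) (words s (suc w))) π∈
... | inj₁ π∈ˡ with ∈-map⁻ (S ∷_) π∈ˡ
...   | _ , π′∈ , refl = map₁ (cong suc) (∈-words⁻ s (suc w) π′∈)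
∈-words⁻ (suc s) (suc w) π∈ | inj₂ π∈ʳ with ∈-map⁻ (W ∷_) π∈ʳ
...   | _ , π′∈ , refl = map₂ (cong suc) (∈-words⁻ (suc s) w π′∈)

∈-words⁺ : ∀ π {s w} → countS π ≡ s → countW π ≡ w → π ∈ words s w
∈-words⁺ []      {zero}  {zero}  refl refl = here refl
∈-words⁺ (S ∷ π) {suc s} {zero}  refl #W   = ∈-map⁺ (S ∷_) (∈-words⁺ π refl #W)
∈-words⁺ (S ∷ π) {suc s} {suc w} refl #W   = ∈-++⁺ˡ (∈-map⁺ (S ∷_) (∈-words⁺ π refl #W))
∈-words⁺ (W ∷ π) {zero}  {suc w} #S   refl = ∈-map⁺ (W ∷_) (∈-words⁺ π #S refl)
∈-words⁺ (W ∷ π) {suc s} {suc w} #S   refl =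
  ∈-++⁺ʳ (map (S ∷_) (words s (suc w))) (∈-map⁺ (W ∷_) (∈-words⁺ π #S refl))

words-unique : ∀ s w → Unique (words s w)
words-unique zero    zero    = [] AllPairs.∷ AllPairs.[]
words-unique zero    (suc w) = Uniqueₚ.map⁺ ∷-injectiveʳ (words-unique zero w)
words-unique (suc s) zero    = Uniqueₚ.map⁺ ∷-injectiveʳ (words-unique s zero)
words-unique (suc s) (suc w) = Uniqueₚ.++⁺ (Uniqueₚ.map⁺ ∷-injectiveʳ (words-unique s (suc w)))
                                           (Uniqueₚ.map⁺ ∷-injectiveʳ (words-unique (suc s) w)) S≢W
  where
  S≢W : ∀ {π} → ¬ (π ∈ map (S ∷_) (words s (suc w)) × π ∈ map (W ∷_) (words (suc s) w))
  S≢W (π∈ˡ , π∈ʳ) with ∈-map⁻ (S ∷_) π∈ˡ | ∈-map⁻ (W ∷_) π∈ʳ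
  ... | _ , _ , refl | _ , _ , ()

-- Parsing paths into trees

StartsWithS : List Letter → Set
StartsWithS (S ∷ _) = ⊤
StartsWithS _       = ⊥

¬StartsWithS-prefixW : ∀ ts π → ¬ StartsWithS π → ¬ StartsWithS (prefixW ts ++ π)
¬StartsWithS-prefixW []      π ¬S = ¬S
¬StartsWithS-prefixW (_ ∷ _) π _  = λ ()

Parse : Set → Set
Parse A = Maybe (A × List ℕ × List Letter)

-- Reads one tree off the front of a path, consuming one part of k⃗ per S-letter; the
-- fuel f bounds the nesting depth.
mutual
  parseTree : ℕ → List ℕ → List Letter → Parse Tree
  parseTree _       ks       []      = just (leaf , ks , [])
  parseTree _       ks       (W ∷ π) = just (leaf , ks , W ∷ π)
  parseTree zero    _        (S ∷ _) = nothing
  parseTree (suc f) []       (S ∷ _) = nothing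
  parseTree (suc f) (k ∷ ks) (S ∷ π) = Maybe.map (map₁ node) (parseChildren f k ks π)

  parseChildren : ℕ → ℕ → List ℕ → List Letter → Parse (List Tree)
  parseChildren f k ks π = parseSiblings f k (parseTree f ks π)

  parseSiblings : ℕ → ℕ → Parse Tree → Parse (List Tree)
  parseSiblings f _       nothing                   = nothing
  parseSiblings f zero    (just (t , ks , π))       = just (t ∷ [] , ks , π)
  parseSiblings f (suc k) (just (t , ks , []))      = nothing
  parseSiblings f (suc k) (just (t , ks , S ∷ π))   = nothing
  parseSiblings f (suc k) (just (t , ks , W ∷ π))   = Maybe.map (map₁ (t ∷_)) (parseChildren f k ks π)

mutual
  parseTree-path : ∀ t ks π {f} → length (arities t) ≤ f → All (1 ≤_) (arities t) → ¬ StartsWithS π →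
                   parseTree f (arities t ++ ks) (path t ++ π) ≡ just (t , ks , π)
  parseTree-path leaf ks []      _ _ _  = refl
  parseTree-path leaf ks (W ∷ π) _ _ _  = refl
  parseTree-path leaf ks (S ∷ π) _ _ ¬S = ⊥-elim (¬S tt)
  parseTree-path (node []) ks π _ (() ∷ _) _
  parseTree-path (node (t ∷ ts)) ks π {suc f} (s≤s fuel) (_ ∷ pos) ¬S =
    cong (Maybe.map (map₁ node)) (parseChildren-joinW t ts ks π fuel pos ¬S)

  parseChildren-joinW : ∀ t ts ks π {f} → length (aritiesᶠ (t ∷ ts)) ≤ f → All (1 ≤_) (aritiesᶠ (t ∷ ts)) →
    ¬ StartsWithS π →
    parseChildren f (length ts) (aritiesᶠ (t ∷ ts) ++ ks) (joinW (t ∷ ts) ++ π) ≡ just (t ∷ ts , ks , π)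
  parseChildren-joinW t ts ks π {f} fuel pos ¬S =
    trans (cong (parseSiblings f (length ts))
                (trans (joinW-split (parseTree f) t ts ks π)
                       (parseTree-path t (aritiesᶠ ts ++ ks) (prefixW ts ++ π)
                                       (≤-trans (length-++-≤ˡ (arities t)) fuel) (Allₚ.++⁻ˡ (arities t) pos)
                                       (¬StartsWithS-prefixW ts π ¬S))))
          (parseSiblings-prefixW t ts ks π fuel pos ¬S)

  parseSiblings-prefixW : ∀ t ts ks π {f} → length (aritiesᶠ (t ∷ ts)) ≤ f → All (1 ≤_) (aritiesᶠ (t ∷ ts)) →
    ¬ StartsWithS π →
    parseSiblings f (length ts) (just (t , aritiesᶠ ts ++ ks , prefixW ts ++ π)) ≡ just (t ∷ ts , ks , π)
  parseSiblings-prefixW t []       ks π fuel pos ¬S = refl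
  parseSiblings-prefixW t (u ∷ us) ks π fuel pos ¬S =
    cong (Maybe.map (map₁ (t ∷_)))
         (parseChildren-joinW u us ks π (≤-trans (length-++-≤ʳ (aritiesᶠ (u ∷ us)) {arities t}) fuel)
                              (Allₚ.++⁻ʳ (arities t) pos) ¬S)

mutual
  parseTree-sound : ∀ f ks π {t ks′ π′} → parseTree f ks π ≡ just (t , ks′ , π′) →
                    ks ≡ arities t ++ ks′ × π ≡ path t ++ π′ × ¬ StartsWithS π′
  parseTree-sound f       ks       []      refl = refl , refl , λ ()
  parseTree-sound f       ks       (W ∷ π) refl = refl , refl , λ ()
  parseTree-sound zero    ks       (S ∷ π) ()
  parseTree-sound (suc f) []       (S ∷ π) ()
  parseTree-sound (suc f) (k ∷ ks) (S ∷ π) eq with parseChildren f k ks π in eqc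
  parseTree-sound (suc f) (k ∷ ks) (S ∷ π) () | nothing
  parseTree-sound (suc f) (k ∷ ks) (S ∷ π) refl | just _ with parseChildren-sound f k ks π eqc
  ... | length≡ , ks≡ , π≡ , ¬S = cong₂ _∷_ (cong pred (sym length≡)) ks≡ , cong (S ∷_) π≡ , ¬S

  parseChildren-sound : ∀ f k ks π {ts ks′ π′} → parseChildren f k ks π ≡ just (ts , ks′ , π′) →
    length ts ≡ suc k × ks ≡ aritiesᶠ ts ++ ks′ × π ≡ joinW ts ++ π′ × ¬ StartsWithS π′
  parseChildren-sound f k ks π eq with parseTree f ks π in eqt
  parseChildren-sound f k ks π () | nothing
  parseChildren-sound f k ks π eq | just (t , ks₁ , π₁) with parseTree-sound f ks π eqt
  ... | refl , refl , ¬S₁ = parseSiblings-sound f k t ks₁ π₁ ¬S₁ eq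

  parseSiblings-sound : ∀ f k t ks₁ π₁ {ts ks′ π′} → ¬ StartsWithS π₁ →
    parseSiblings f k (just (t , ks₁ , π₁)) ≡ just (ts , ks′ , π′) →
    length ts ≡ suc k × arities t ++ ks₁ ≡ aritiesᶠ ts ++ ks′ × path t ++ π₁ ≡ joinW ts ++ π′
                      × ¬ StartsWithS π′
  parseSiblings-sound f zero    t ks₁ π₁       ¬S refl =
    refl , cong (_++ ks₁) (sym (++-identityʳ (arities t))) , cong (_++ π₁) (sym (++-identityʳ (path t))) , ¬S
  parseSiblings-sound f (suc k) t ks₁ []       _  ()
  parseSiblings-sound f (suc k) t ks₁ (S ∷ π₁) ¬S _ = ⊥-elim (¬S tt)
  parseSiblings-sound f (suc k) t ks₁ (W ∷ π₁) _  eq with parseChildren f k ks₁ π₁ in eqc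
  parseSiblings-sound f (suc k) t ks₁ (W ∷ π₁) _ () | nothing
  parseSiblings-sound f (suc k) t ks₁ (W ∷ π₁) _ refl | just ([] , _) with parseChildren-sound f k ks₁ π₁ eqc
  ... | () , _
  parseSiblings-sound f (suc k) t ks₁ (W ∷ π₁) _ refl | just (u ∷ us , ks′ , π′)
    with parseChildren-sound f k ks₁ π₁ eqc
  ... | length≡ , refl , refl , ¬S =
    cong suc length≡ , sym (++-assoc (arities t) (aritiesᶠ (u ∷ us)) ks′) ,
    sym (++-assoc (path t) (prefixW (u ∷ us)) π′) , ¬S

-- `areaSeq` alone does not check that the path ends at rank 0; the count of W does.
DyckFrom : ℕ → List ℕ → List Letter → Set
DyckFrom r ks π = T (is-just (areaSeq ks r π)) × countW π ≡ r + sum ks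

dyckFrom-S : ∀ r k ks π → DyckFrom r (k ∷ ks) (S ∷ π) → DyckFrom (r + k) ks π
dyckFrom-S r k ks π (ok , #W) = is-just-map⁻ (areaSeq ks (r + k) π) ok , trans #W (sym (+-assoc r k (sum ks)))
  where
  is-just-map⁻ : ∀ m → T (is-just (Maybe.map (r ∷_) m)) → T (is-just m)
  is-just-map⁻ (just _) _ = tt

dyckFrom-W : ∀ r ks π → DyckFrom (suc r) ks (W ∷ π) → DyckFrom r ks π
dyckFrom-W r ks π (ok , #W) = subst (T ∘ is-just) (areaSeq-W ks r π) ok , suc-injective #W

record Succeeds {A : Set} (f r : ℕ) (result : Parse A) : Set where
  field
    value  : A
    ks′    : List ℕ
    π′     : List Letter
    parsed : result ≡ just (value , ks′ , π′)
    fuel   : length ks′ ≤ f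
    dyck   : DyckFrom r ks′ π′

succeeds-map : ∀ {A B : Set} (g : A → B) {f f′ r m} → f ≤ f′ →
               Succeeds f r m → Succeeds f′ r (Maybe.map (map₁ g) m)
succeeds-map g f≤f′ C = record
  { parsed = cong (Maybe.map (map₁ g)) parsed ; fuel = ≤-trans fuel f≤f′ ; dyck = dyck }
  where open Succeeds C

mutual
  parseTree-complete : ∀ f ks r π → length ks ≤ f → DyckFrom r ks π → Succeeds f r (parseTree f ks π)
  parseTree-complete f       ks       r []      fuel d = record { parsed = refl ; fuel = fuel ; dyck = d }
  parseTree-complete f       ks       r (W ∷ π) fuel d = record { parsed = refl ; fuel = fuel ; dyck = d }
  parseTree-complete f       []       r (S ∷ π) _    (() , _)
  parseTree-complete (suc f) (k ∷ ks) r (S ∷ π) (s≤s fuel) d =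
    succeeds-map node (n≤1+n f) (parseChildren-complete f k ks r π fuel (dyckFrom-S r k ks π d))

  parseChildren-complete : ∀ f k ks r π → length ks ≤ f → DyckFrom (r + k) ks π →
                           Succeeds f r (parseChildren f k ks π)
  parseChildren-complete f k ks r π fuel d =
    subst (Succeeds f r ∘ parseSiblings f k) (sym C.parsed)
          (parseSiblings-complete f k C.value C.ks′ C.π′ r (proj₂ (proj₂ (parseTree-sound f ks π C.parsed)))
                                  C.fuel C.dyck)
    where module C = Succeeds (parseTree-complete f ks (r + k) π fuel d)

  parseSiblings-complete : ∀ f k t ks₁ π₁ r → ¬ StartsWithS π₁ → length ks₁ ≤ f → DyckFrom (r + k) ks₁ π₁ →
                           Succeeds f r (parseSiblings f k (just (t , ks₁ , π₁)))
  parseSiblings-complete f zero    t ks₁ π₁ r _ fuel d = record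
    { parsed = refl ; fuel = fuel ; dyck = subst (λ r′ → DyckFrom r′ ks₁ π₁) (+-identityʳ r) d }
  parseSiblings-complete f (suc k) t ks₁ [] r _ _ (_ , #W) =
    ⊥-elim (0≢1+n (trans #W (cong (_+ sum ks₁) (+-suc r k))))
  parseSiblings-complete f (suc k) t ks₁ (S ∷ π₁) r ¬S _ _ = ⊥-elim (¬S tt)
  parseSiblings-complete f (suc k) t ks₁ (W ∷ π₁) r _ fuel d =
    succeeds-map (t ∷_) ≤-refl
      (parseChildren-complete f k ks₁ r π₁ fuel
        (dyckFrom-W (r + k) ks₁ π₁ (subst (λ r′ → DyckFrom r′ ks₁ (W ∷ π₁)) (+-suc r k) d)))

areaSeq-0-¬S⇒[] : ∀ ks π → ¬ StartsWithS π → T (is-just (areaSeq ks 0 π)) → ks ≡ [] × π ≡ []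
areaSeq-0-¬S⇒[] []      []      _  _ = refl , refl
areaSeq-0-¬S⇒[] []      (W ∷ _) _  ()
areaSeq-0-¬S⇒[] (_ ∷ _) (W ∷ _) _  ()
areaSeq-0-¬S⇒[] _       (S ∷ _) ¬S _ = ⊥-elim (¬S tt)

parseTree-dyck : ∀ ks π → DyckFrom 0 ks π → Σ Tree λ t → parseTree (length ks) ks π ≡ just (t , [] , [])
parseTree-dyck ks π d =
  C.value , trans C.parsed (cong₂ (λ ks′ π′ → just (C.value , ks′ , π′)) (proj₁ rest≡[]) (proj₂ rest≡[]))
  where
  module C = Succeeds (parseTree-complete (length ks) ks 0 π ≤-refl d)
  rest≡[] : C.ks′ ≡ [] × C.π′ ≡ []
  rest≡[] = areaSeq-0-¬S⇒[] C.ks′ C.π′ (proj₂ (proj₂ (parseTree-sound (length ks) ks π C.parsed)))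
                            (proj₁ C.dyck)

-- Mirroring Dyck paths

∈-DyckPaths⁻ : ∀ {ks π} → π ∈ DyckPaths ks → Σ Tree λ t → arities t ≡ ks × π ≡ path t
∈-DyckPaths⁻ {ks} {π} π∈
  with ∈-filter⁻ (T? ∘ λ π → is-just (areaSeq ks 0 π)) {xs = words (length ks) (sum ks)} π∈
... | π∈words , ok with parseTree-dyck ks π (ok , proj₂ (∈-words⁻ (length ks) (sum ks) π∈words))
... | t , parsed with parseTree-sound (length ks) ks π parsed
... | ks≡ , π≡ , _ = t , sym (trans ks≡ (++-identityʳ (arities t))) , trans π≡ (++-identityʳ (path t))

path-∈-DyckPaths : ∀ t → path t ∈ DyckPaths (arities t)
path-∈-DyckPaths t = ∈-filter⁺ (T? ∘ λ π → is-just (areaSeq (arities t) 0 π))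
  (∈-words⁺ (path t) (countS-path t) (countW-path t)) (subst (T ∘ is-just) (sym (areaSeq-path-[] t 0)) tt)

area-path-mirror : ∀ {ks} t → arities t ≡ ks → arities (mirror t) ≡ ks →
                   area ks (path (mirror t)) ≡ depth ks (path t)
area-path-mirror t refl mirror≡ = begin
  area (arities t) (path (mirror t))           ≡⟨ cong (λ ks → area ks (path (mirror t))) mirror≡ ⟨
  area (arities (mirror t)) (path (mirror t))  ≡⟨ area-path (mirror t) ⟩
  sum (ranks (mirror t) 0)                     ≡⟨ sum-ranks-mirror t 0 ⟩
  depthᵗ t 0                                   ≡⟨ depth-path t ⟨
  depth (arities t) (path t)                   ∎
  where open ≡-Reasoning

depth-path-mirror : ∀ {ks} t → arities t ≡ ks → arities (mirror t) ≡ ks →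
                    depth ks (path (mirror t)) ≡ area ks (path t)
depth-path-mirror t refl mirror≡ = begin
  depth (arities t) (path (mirror t))           ≡⟨ cong (λ ks → depth ks (path (mirror t))) mirror≡ ⟨
  depth (arities (mirror t)) (path (mirror t))  ≡⟨ depth-path (mirror t) ⟩
  depthᵗ (mirror t) 0                           ≡⟨ depth-mirror t 0 ⟩
  sum (ranks t 0)                               ≡⟨ area-path t ⟨
  area (arities t) (path t)                     ∎
  where open ≡-Reasoning

whole : Parse Tree → Maybe Tree
whole (just (t , [] , []))    = just t
whole (just (_ , [] , _ ∷ _)) = nothing
whole (just (_ , _ ∷ _ , _))  = nothing
whole nothing                 = nothing

whole-just : ∀ m {t} → whole m ≡ just t → m ≡ just (t , [] , [])
whole-just (just (t , [] , [])) refl = refl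
whole-just (just (_ , [] , _ ∷ _)) ()
whole-just (just (_ , _ ∷ _ , _))  ()
whole-just nothing                 ()

module Symmetry (ks : List ℕ) (positive : All (1 ≤_) ks)
                (arities-mirror≡ : ∀ t → arities t ≡ ks → arities (mirror t) ≡ ks) where

  decode : List Letter → Maybe Tree
  decode π = whole (parseTree (length ks) ks π)

  decode-sound : ∀ π {t} → decode π ≡ just t → π ≡ path t × arities t ≡ ks
  decode-sound π {t} eq with parseTree-sound (length ks) ks π (whole-just (parseTree (length ks) ks π) eq)
  ... | ks≡ , π≡ , _ = trans π≡ (++-identityʳ (path t)) , sym (trans ks≡ (++-identityʳ (arities t)))

  decode-path : ∀ t → arities t ≡ ks → decode (path t) ≡ just t
  decode-path t refl = cong whole (begin
    parseTree (length ks) (arities t) (path t)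
      ≡⟨ cong₂ (parseTree (length ks)) (++-identityʳ (arities t)) (++-identityʳ (path t)) ⟨
    parseTree (length ks) (arities t ++ []) (path t ++ [])
      ≡⟨ parseTree-path t [] [] ≤-refl positive (λ ()) ⟩
    just (t , [] , []) ∎)
    where open ≡-Reasoning

  mirrorPath : List Letter → List Letter
  mirrorPath π = maybe (path ∘ mirror) π (decode π)

  mirrorPath-path : ∀ t → arities t ≡ ks → mirrorPath (path t) ≡ path (mirror t)
  mirrorPath-path t ar≡ = cong (maybe (path ∘ mirror) (path t)) (decode-path t ar≡)

  mirrorPath-involutive : ∀ π → mirrorPath (mirrorPath π) ≡ π
  mirrorPath-involutive π with decode π in eq
  ... | nothing rewrite eq = refl
  ... | just t with decode-sound π eq
  ...   | refl , ar≡ =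
    trans (mirrorPath-path (mirror t) (arities-mirror≡ t ar≡)) (cong path (mirror-involutive t))

  mirrorPath-∈ : ∀ {π} → π ∈ DyckPaths ks → mirrorPath π ∈ DyckPaths ks
  mirrorPath-∈ π∈ with ∈-DyckPaths⁻ π∈
  ... | t , ar≡ , refl rewrite mirrorPath-path t ar≡ =
    subst (λ ks′ → path (mirror t) ∈ DyckPaths ks′) (arities-mirror≡ t ar≡) (path-∈-DyckPaths (mirror t))

  swap-statistics : ∀ i j {π} → π ∈ DyckPaths ks →
    ((area ks (mirrorPath π) ≡ᵇ i) ∧ (depth ks (mirrorPath π) ≡ᵇ j))
      ≡ ((area ks π ≡ᵇ j) ∧ (depth ks π ≡ᵇ i))
  swap-statistics i j π∈ with ∈-DyckPaths⁻ π∈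
  ... | t , ar≡ , refl = begin
    (area ks (mirrorPath (path t)) ≡ᵇ i) ∧ (depth ks (mirrorPath (path t)) ≡ᵇ j)
      ≡⟨ cong (λ π → (area ks π ≡ᵇ i) ∧ (depth ks π ≡ᵇ j)) (mirrorPath-path t ar≡) ⟩
    (area ks (path (mirror t)) ≡ᵇ i) ∧ (depth ks (path (mirror t)) ≡ᵇ j)
      ≡⟨ cong₂ (λ x y → (x ≡ᵇ i) ∧ (y ≡ᵇ j))
               (area-path-mirror t ar≡ mirror≡) (depth-path-mirror t ar≡ mirror≡) ⟩
    (depth ks (path t) ≡ᵇ i) ∧ (area ks (path t) ≡ᵇ j)
      ≡⟨ ∧-comm (depth ks (path t) ≡ᵇ i) (area ks (path t) ≡ᵇ j) ⟩
    (area ks (path t) ≡ᵇ j) ∧ (depth ks (path t) ≡ᵇ i) ∎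
    where
    open ≡-Reasoning
    mirror≡ = arities-mirror≡ t ar≡

  symmetric : qtSymmetric ks
  symmetric i j = begin
    length (filterᵇ (λ π → (area ks π ≡ᵇ i) ∧ (depth ks π ≡ᵇ j)) (DyckPaths ks))
      ≡⟨ count-involution mirrorPath mirrorPath-involutive
           (Uniqueₚ.filter⁺ _ (words-unique (length ks) (sum ks))) mirrorPath-∈ _ ⟩
    length (filterᵇ (λ π → (area ks (mirrorPath π) ≡ᵇ i) ∧ (depth ks (mirrorPath π) ≡ᵇ j)) (DyckPaths ks))
      ≡⟨ cong length (filterᵇ-cong-∈ (DyckPaths ks) (swap-statistics i j)) ⟩
    length (filterᵇ (λ π → (area ks π ≡ᵇ j) ∧ (depth ks π ≡ᵇ i)) (DyckPaths ks)) ∎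
    where open ≡-Reasoning

-- Mirroring only permutes the arities below the root.
arities-mirror-spine : ∀ a b m t → arities t ≡ a ∷ replicate m b →
                       arities (mirror t) ≡ a ∷ replicate m b
arities-mirror-spine a b m leaf      ()
arities-mirror-spine a b m (node ts) eq with ∷-injective eq
... | root≡ , below≡ = cong₂ _∷_
  (trans (cong pred (trans (length-reverse (mirrorᶠ ts)) (length-mirrorᶠ ts))) root≡)
  (↭-replicate m (subst (aritiesᶠ (reverse (mirrorᶠ ts)) ↭_) below≡ (aritiesᶠ-mirror ts)))

corollary5p2 : ((a b m : ℕ) → 1 ≤ a → 1 ≤ b → qtSymmetric (a ∷ replicate m b))
    × ((a b : ℕ) → 1 ≤ a → 1 ≤ b → qtSymmetric (a ∷ b ∷ []))
corollary5p2 = spine , (λ a b → spine a b 1)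
  where
  spine : (a b m : ℕ) → 1 ≤ a → 1 ≤ b → qtSymmetric (a ∷ replicate m b)
  spine a b m 1≤a 1≤b =
    Symmetry.symmetric (a ∷ replicate m b) (1≤a ∷ Allₚ.replicate⁺ m 1≤b) (arities-mirror-spine a b m)
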